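{- Let $W$ be a latin trade. Then $W$ can be embedded in a finite abelian group if and only if $W$ can be embedded in a finitely generated abelian group.
   Context: A partial latin square (PLS) is a finite set of triples (row, column, symbol) such that any two distinct triples agree in at most one coordinate. A latin bitrade is a pair $(W,B)$ of non-empty PLS such that for each $(r,c,s)\in W$ (respectively $B$) there exist unique $r'\ne r$, $c'\ne c$, $s'\ne s$ with $(r',c,s),(r,c',s),(r,c,s')\in B$ (respectively $W$); $W$ is then called a latin trade. A PLS $P$ with row, column, symbol sets $R,C,S$ embeds in an abelian group $H$ if there are injections $f:R\to H$, $h:C\to H$, $k:S\to H$ with $f(r)+h(c)=k(s)$ for all $(r,c,s)\in P$. -}

module Defs where

open import Level using (0ℓ)
open import Data.Nat using (ℕ; zero; suc)
open import Data.Integer using (ℤ; +_; -[1+_])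
open import Data.Fin using (Fin; zero; suc)
open import Data.Product using (Σ; ∃; ∃-syntax; _×_; _,_)
open import Data.List using (List; [])
open import Data.List.Membership.Propositional using (_∈_)
open import Relation.Binary.PropositionalEquality using (_≡_; _≢_)
open import Relation.Nullary using (¬_)
open import Function using (_⇔_)
open import Algebra.Bundles using (AbelianGroup)

-- A triple (row, column, symbol); labels are natural numbers.
Triple : Set
Triple = ℕ × ℕ × ℕ

-- A partial latin square: a finite set of triples (given as a list, read as
-- the set of its members) such that two distinct triples agree in at most one
-- coordinate.
IsPLS : List Triple → Set
IsPLS P = ∀ {r c s r′ c′ s′} → (r , c , s) ∈ P → (r′ , c′ , s′) ∈ P →
  (r , c , s) ≢ (r′ , c′ , s′) →
    ¬ (r ≡ r′ × c ≡ c′) × ¬ (r ≡ r′ × s ≡ s′) × ¬ (c ≡ c′ × s ≡ s′)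

NonEmpty : List Triple → Set
NonEmpty P = P ≢ []

Mates : List Triple → List Triple → Set
Mates X Y = ∀ {r c s} → (r , c , s) ∈ X →
    (∃[ r′ ] (r′ ≢ r × (r′ , c , s) ∈ Y ×
        (∀ r″ → r″ ≢ r → (r″ , c , s) ∈ Y → r″ ≡ r′)))
  × (∃[ c′ ] (c′ ≢ c × (r , c′ , s) ∈ Y ×
        (∀ c″ → c″ ≢ c → (r , c″ , s) ∈ Y → c″ ≡ c′)))
  × (∃[ s′ ] (s′ ≢ s × (r , c , s′) ∈ Y ×
        (∀ s″ → s″ ≢ s → (r , c , s″) ∈ Y → s″ ≡ s′)))

IsBitrade : List Triple → List Triple → Set
IsBitrade W B = IsPLS W × IsPLS B × NonEmpty W × NonEmpty B × Mates W B × Mates B W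

IsLatinTrade : List Triple → Set
IsLatinTrade W = ∃[ B ] IsBitrade W B

module _ (G : AbelianGroup 0ℓ 0ℓ) where
  open AbelianGroup G

  Embeds : List Triple → Set
  Embeds P = Σ (ℕ → Carrier) λ f → Σ (ℕ → Carrier) λ h → Σ (ℕ → Carrier) λ k →
      (∀ {r c s r′ c′ s′} → (r , c , s) ∈ P → (r′ , c′ , s′) ∈ P → f r ≈ f r′ → r ≡ r′)
    × (∀ {r c s r′ c′ s′} → (r , c , s) ∈ P → (r′ , c′ , s′) ∈ P → h c ≈ h c′ → c ≡ c′)
    × (∀ {r c s r′ c′ s′} → (r , c , s) ∈ P → (r′ , c′ , s′) ∈ P → k s ≈ k s′ → s ≡ s′)
    × (∀ {r c s} → (r , c , s) ∈ P → (f r ∙ h c) ≈ k s)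

  IsFinite : Set
  IsFinite = ∃[ n ] Σ (Fin n → Carrier) λ e → ∀ x → ∃[ i ] (e i ≈ x)

  natMul : ℕ → Carrier → Carrier
  natMul zero x = ε
  natMul (suc n) x = x ∙ natMul n x

  intMul : ℤ → Carrier → Carrier
  intMul (+ n) x = natMul n x
  intMul -[1+ n ] x = (natMul (suc n) x) ⁻¹

  sumFin : ∀ n → (Fin n → Carrier) → Carrier
  sumFin zero v = ε
  sumFin (suc n) v = v zero ∙ sumFin n (λ i → v (suc i))

  IsFinitelyGenerated : Set
  IsFinitelyGenerated = ∃[ n ] Σ (Fin n → Carrier) λ g →
    ∀ x → Σ (Fin n → ℤ) λ z → x ≈ sumFin n (λ i → intMul (z i) (g i))

EmbedsInFiniteAbelianGroup : List Triple → Set₁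
EmbedsInFiniteAbelianGroup P =
  Σ (AbelianGroup 0ℓ 0ℓ) λ G → IsFinite G × Embeds G P

EmbedsInFinitelyGeneratedAbelianGroup : List Triple → Set₁
EmbedsInFinitelyGeneratedAbelianGroup P =
  Σ (AbelianGroup 0ℓ 0ℓ) λ G → IsFinitelyGenerated G × Embeds G P

module Submission where

-- A finite group is generated by its own elements, so one direction is
-- immediate.  Conversely, let W embed in an abelian group G generated by
-- gen₁, …, genₙ.  Choose integer coordinates z(x) ∈ ℤⁿ for every x ∈ G and
-- let L ⊆ ℤⁿ be the subgroup spanned by the relation vectors
-- z(f r) + z(h c) - z(k s), one for each triple of W.  As L lies in the kernel
-- of the evaluation map ℤⁿ → G, labels with distinct images have coordinates
-- that are distinct modulo L.  The heart of the proof is that ℤⁿ / L is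
-- residually finite: each d ∉ L stays outside L + Mℤⁿ for some M ≥ 1.  This is
-- shown by induction on n, eliminating the first coordinate with a pivot whose
-- head is the gcd of the generators' heads (Bézout).  A common multiple M of
-- the moduli needed for the finitely many pairs of labels then embeds W in the
-- finite group ℤⁿ / (L + Mℤⁿ).

open import Defs
open import Function using (_⇔_; mk⇔; _∘_)
open import Level using (0ℓ)
open import Data.Nat as ℕ using (ℕ; zero; suc; _^_)
import Data.Nat.Properties as ℕ
import Data.Nat.Divisibility as ℕ
open import Data.Nat.GCD using (gcd; gcd[m,n]∣m; gcd[m,n]∣n; gcd-GCD; module Bézout)
open import Data.Integer as ℤ using (ℤ; +_; -[1+_]; _+_; _*_; -_; _-_; 0ℤ; 1ℤ; ∣_∣)
import Data.Integer.Properties as ℤ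
open import Data.Integer.Divisibility.Signed
  using (_∣_; divides; ∣ᵤ⇒∣; ∣-trans; ∣m∣∣m; m∣∣m∣; _∣?_)
open import Data.Integer.DivMod using (_/ℕ_; _%ℕ_; n%ℕd<d; a≡a%ℕn+[a/ℕn]*n)
open import Data.Integer.Tactic.RingSolver using (solve-∀)
open import Data.Fin using (Fin; zero; suc; toℕ; fromℕ<; combine; remQuot)
import Data.Fin.Properties as Fin
open import Data.Vec.Functional using (Vector; head; tail) renaming (_∷_ to _∷ᵛ_)
open import Data.Product using (Σ; ∃; ∃-syntax; ∃₂; _×_; _,_; proj₁; proj₂; uncurry)
open import Data.List using (List; []; _∷_; map; cartesianProduct)
open import Data.List.Membership.Propositional using (_∈_)
open import Data.List.Membership.Propositional.Properties
  using (∈-map⁺; ∈-map⁻; ∈-cartesianProduct⁺; ∈-cartesianProduct⁻)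
open import Data.List.Relation.Unary.Any using (here; there)
open import Data.List.Relation.Unary.All as All using (All; []; _∷_)
open import Relation.Binary.PropositionalEquality
  using (_≡_; _≢_; refl; sym; trans; cong; cong₂; _≗_; module ≡-Reasoning)
open import Relation.Nullary using (¬_; Dec; yes; no)
open import Data.Empty using (⊥-elim)
open import Algebra.Bundles using (AbelianGroup)
open import Algebra.Structures using (IsAbelianGroup)

ℤ^ : ℕ → Set
ℤ^ n = Vector ℤ n

module _ {n : ℕ} where
  infixl 6 _⊕_ _⊖_
  infixr 7 _⊛_

  𝟎 : ℤ^ n
  𝟎 _ = 0ℤ

  _⊕_ _⊖_ : ℤ^ n → ℤ^ n → ℤ^ n
  (u ⊕ v) i = u i + v i
  (u ⊖ v) i = u i - v i

  ⊝_ : ℤ^ n → ℤ^ n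
  (⊝ u) i = - u i

  _⊛_ : ℤ → ℤ^ n → ℤ^ n
  (c ⊛ u) i = c * u i

-- The subgroup ⟨gs⟩ of ℤⁿ generated by a finite list of vectors.  Each
-- constructor holds up to pointwise equality, so no function
-- extensionality is needed.
data Span {n} (gs : List (ℤ^ n)) : ℤ^ n → Set where
  zero-mem : ∀ {w} → w ≗ 𝟎 → Span gs w
  gen-mem  : ∀ {g w} → g ∈ gs → w ≗ g → Span gs w
  add-mem  : ∀ {u v w} → Span gs u → Span gs v → w ≗ u ⊕ v → Span gs w
  neg-mem  : ∀ {u w} → Span gs u → w ≗ ⊝ u → Span gs w

module _ {n} {gs : List (ℤ^ n)} where

  span-resp : ∀ {u w} → Span gs u → w ≗ u → Span gs w
  span-resp (zero-mem e)  w≗u = zero-mem (λ i → trans (w≗u i) (e i))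
  span-resp (gen-mem p e) w≗u = gen-mem p (λ i → trans (w≗u i) (e i))
  span-resp (add-mem s t e) w≗u = add-mem s t (λ i → trans (w≗u i) (e i))
  span-resp (neg-mem s e) w≗u = neg-mem s (λ i → trans (w≗u i) (e i))

  span-sub : ∀ {u v w} → Span gs u → Span gs v → w ≗ u ⊖ v → Span gs w
  span-sub s t = add-mem s (neg-mem t (λ _ → refl))

  span-scaleℕ : ∀ {u} k → Span gs u → Span gs (+ k ⊛ u)
  span-scaleℕ {u} zero    s = zero-mem (λ i → ℤ.*-zeroˡ (u i))
  span-scaleℕ {u} (suc k) s = add-mem s (span-scaleℕ k s) (λ i → ℤ.suc-* (+ k) (u i))

  span-scale : ∀ {u} c → Span gs u → Span gs (c ⊛ u)
  span-scale (+ k)    s = span-scaleℕ k s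
  span-scale {u} -[1+ k ] s =
    neg-mem (span-scaleℕ (suc k) s) (λ i → sym (ℤ.neg-distribˡ-* (+ suc k) (u i)))

span-weaken : ∀ {n} {g} {gs : List (ℤ^ n)} {u} → Span gs u → Span (g ∷ gs) u
span-weaken (zero-mem e)    = zero-mem e
span-weaken (gen-mem p e)   = gen-mem (there p) e
span-weaken (add-mem s t e) = add-mem (span-weaken s) (span-weaken t) e
span-weaken (neg-mem s e)   = neg-mem (span-weaken s) e

difference-in-ℤ : ∀ d a b x y → d ℕ.+ y ℕ.* b ≡ x ℕ.* a → + x * + a + - + y * + b ≡ + d
difference-in-ℤ d a b x y eq = begin
  + x * + a + - + y * + b             ≡⟨ cong (_+ - + y * + b) (sym (ℤ.pos-* x a)) ⟩
  + (x ℕ.* a) + - + y * + b           ≡⟨ cong (λ z → + z + - + y * + b) (sym eq) ⟩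
  + (d ℕ.+ y ℕ.* b) + - + y * + b     ≡⟨ cong (_+ - + y * + b) (ℤ.pos-+ d (y ℕ.* b)) ⟩
  + d + + (y ℕ.* b) + - + y * + b     ≡⟨ cong (λ z → + d + z + - + y * + b) (ℤ.pos-* y b) ⟩
  + d + + y * + b + - + y * + b       ≡⟨ cancel (+ d) (+ y) (+ b) ⟩
  + d                                 ∎
  where
  open ≡-Reasoning
  cancel : ∀ d y b → d + y * b + - y * b ≡ d
  cancel = solve-∀

bezout : ∀ a b → ∃₂ λ u v → u * + a + v * + b ≡ + gcd a b
bezout a b with Bézout.identity (gcd-GCD a b)
... | Bézout.+- x y eq = + x , - + y , difference-in-ℤ _ a b x y eq
... | Bézout.-+ x y eq = - + x , + y ,
  trans (ℤ.+-comm (- + x * + a) (+ y * + b)) (difference-in-ℤ _ b a y x eq)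

-- Hence the first coordinates of ⟨gs⟩ form exactly the ideal gℤ.
record Pivot {m} (gs : List (ℤ^ (suc m))) (g : ℕ) : Set where
  field
    vector        : ℤ^ (suc m)
    vector∈       : Span gs vector
    head≡         : head vector ≡ + g
    divides-heads : All (λ ℓ → + g ∣ head ℓ) gs

-- Every finite list of generators has a pivot (g is the gcd of their first
-- coordinates, built up by Bézout one generator at a time).
pivot-exists : ∀ {m} (gs : List (ℤ^ (suc m))) → ∃ (Pivot gs)
pivot-exists [] = 0 , record
  { vector = 𝟎 ; vector∈ = zero-mem (λ _ → refl) ; head≡ = refl ; divides-heads = [] }
pivot-exists (ℓ ∷ gs) with pivot-exists gs | m∣∣m∣ {head ℓ}
... | g′ , P′ | divides s ∣a∣≡s*a with bezout ∣ head ℓ ∣ g′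
... | u , v , bez = gcd (∣ head ℓ ∣) g′ , record
  { vector        = (u * s) ⊛ ℓ ⊕ v ⊛ P.vector
  ; vector∈       = add-mem (span-scale (u * s) (gen-mem (here refl) (λ _ → refl)))
                            (span-scale v (span-weaken P.vector∈)) (λ _ → refl)
  ; head≡         = head-combination
  ; divides-heads = ∣-trans (∣ᵤ⇒∣ (gcd[m,n]∣m (∣ head ℓ ∣) g′)) ∣m∣∣m
                  ∷ All.map (∣-trans (∣ᵤ⇒∣ (gcd[m,n]∣n (∣ head ℓ ∣) g′))) P.divides-heads
  }
  where
  module P = Pivot P′
  open ≡-Reasoning
  head-combination : u * s * head ℓ + v * head P.vector ≡ + gcd (∣ head ℓ ∣) g′
  head-combination = begin
    u * s * head ℓ + v * head P.vector
      ≡⟨ cong₂ (λ x y → x + v * y) (ℤ.*-assoc u s (head ℓ)) P.head≡ ⟩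
    u * (s * head ℓ) + v * + g′
      ≡⟨ cong (λ x → u * x + v * + g′) (sym ∣a∣≡s*a) ⟩
    u * + (∣ head ℓ ∣) + v * + g′
      ≡⟨ bez ⟩
    + gcd (∣ head ℓ ∣) g′
      ∎

SpanMod : ∀ {n} → List (ℤ^ n) → ℕ → ℤ^ n → Set
SpanMod gs M d = ∃[ y ] Span gs (d ⊖ + M ⊛ y)

Separable : ∀ {n} → List (ℤ^ n) → ℤ^ n → Set
Separable gs d = ∃[ N ] ¬ SpanMod gs (suc N) d

no-large-multiple : ∀ x y .{{_ : ℤ.NonZero y}} → x ≢ + suc ∣ x ∣ * y
no-large-multiple x y eq = ℕ.<-irrefl refl (ℕ.≤-trans (ℕ.m≤m*n (suc ∣ x ∣) ∣ y ∣)
  (ℕ.≤-reflexive (sym (trans (cong ∣_∣ eq) (ℤ.abs-* (+ suc ∣ x ∣) y)))))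

-- One-dimensional residual finiteness: if x ∉ gℤ then x ∉ gℤ + Mℤ for some
-- M ≥ 1 (namely M = g, or M = 1 + ∣x∣ when g = 0).
separate-ideal : ∀ g x → ¬ (+ g ∣ x) → ∃[ N ] ∀ t y → x - + suc N * y ≢ t * + g
separate-ideal (suc n) x g∤x = n , λ t y eq → g∤x (divides (t + y) (begin
  x                               ≡⟨ split x (+ suc n) y ⟩
  (x - + suc n * y) + y * + suc n ≡⟨ cong (_+ y * + suc n) eq ⟩
  t * + suc n + y * + suc n       ≡⟨ ℤ.*-distribʳ-+ (+ suc n) t y ⟨
  (t + y) * + suc n               ∎))
  where
  open ≡-Reasoning
  split : ∀ x G y → x ≡ (x - G * y) + y * G
  split = solve-∀
separate-ideal zero x 0∤x = ∣ x ∣ , λ t y eq → x-is-multiple y (begin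
  x                                       ≡⟨ split x (+ suc ∣ x ∣ * y) ⟩
  (x - + suc ∣ x ∣ * y) + + suc ∣ x ∣ * y ≡⟨ cong (_+ + suc ∣ x ∣ * y) (trans eq (ℤ.*-zeroʳ t)) ⟩
  0ℤ + + suc ∣ x ∣ * y                    ≡⟨ ℤ.+-identityˡ _ ⟩
  + suc ∣ x ∣ * y                         ∎)
  where
  open ≡-Reasoning
  split : ∀ x z → x ≡ (x - z) + z
  split = solve-∀
  x-is-multiple : ∀ y → x ≢ + suc ∣ x ∣ * y
  x-is-multiple (+ zero) x≡0 = 0∤x (divides 0ℤ (trans x≡0 (ℤ.*-zeroʳ (+ suc ∣ x ∣))))
  x-is-multiple y@(+ suc _)  = no-large-multiple x y
  x-is-multiple y@(-[1+ _ ]) = no-large-multiple x y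

-- Write every generator as
-- ℓ = (q·g, ℓ′) and the pivot as (g, p′); then ℓ - q·pivot = (0, ℓ′ - q·p′).
-- By lift and decompose, the pivot and these reduced generators (placed in
-- 0 × ℤᵐ) generate ⟨gs⟩.
module Reduction {m} {gs : List (ℤ^ (suc m))} {g : ℕ} (P : Pivot gs g) where
  open Pivot P

  HeadQuotients : List (ℤ^ (suc m)) → Set
  HeadQuotients = All (λ ℓ → + g ∣ head ℓ)

  reduce : ∀ {hs} → HeadQuotients hs → List (ℤ^ m)
  reduce []                             = []
  reduce {ℓ ∷ _} (divides q _ ∷ quots) = tail ℓ ⊖ q ⊛ tail vector ∷ reduce quots

  reduced : List (ℤ^ m)
  reduced = reduce divides-heads

  reduce∈ : ∀ {hs ℓ} (quots : HeadQuotients hs) (ℓ∈ : ℓ ∈ hs) →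
            tail ℓ ⊖ _∣_.quotient (All.lookup quots ℓ∈) ⊛ tail vector ∈ reduce quots
  reduce∈ (_ ∷ _)     (here refl) = here refl
  reduce∈ (_ ∷ quots) (there ℓ∈)  = there (reduce∈ quots ℓ∈)

  reduce∈⁻ : ∀ {hs w} (quots : HeadQuotients hs) → w ∈ reduce quots →
             ∃₂ λ ℓ q → ℓ ∈ hs × head ℓ ≡ q * + g × w ≡ tail ℓ ⊖ q ⊛ tail vector
  reduce∈⁻ {ℓ ∷ _} (divides q eq ∷ _) (here refl) = ℓ , q , here refl , eq , refl
  reduce∈⁻ (_ ∷ quots) (there w∈) with reduce∈⁻ quots w∈
  ... | ℓ , q , ℓ∈ , eq , w≡ = ℓ , q , there ℓ∈ , eq , w≡

  lift : ∀ {w} → Span reduced w → Span gs (0ℤ ∷ᵛ w)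
  lift (zero-mem e)    = zero-mem λ { zero → refl ; (suc i) → e i }
  lift (add-mem s t e) = add-mem (lift s) (lift t) λ { zero → refl ; (suc i) → e i }
  lift (neg-mem s e)   = neg-mem (lift s) λ { zero → refl ; (suc i) → e i }
  lift {w} (gen-mem w′∈ e) with reduce∈⁻ divides-heads w′∈
  ... | ℓ , q , ℓ∈ , head≡q*g , refl =
    span-sub (gen-mem ℓ∈ (λ _ → refl)) (span-scale q vector∈) pointwise
    where
    pointwise : 0ℤ ∷ᵛ w ≗ ℓ ⊖ q ⊛ vector
    pointwise zero = sym (begin
      head ℓ - q * head vector  ≡⟨ cong₂ (λ x y → x - q * y) head≡q*g head≡ ⟩
      q * + g - q * + g         ≡⟨ ℤ.+-inverseʳ (q * + g) ⟩
      0ℤ                        ∎)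
      where open ≡-Reasoning
    pointwise (suc i) = e i

  decompose : ∀ {ℓ} → Span gs ℓ →
              ∃[ t ] head ℓ ≡ t * + g × Span reduced (tail ℓ ⊖ t ⊛ tail vector)
  decompose (zero-mem e) =
    0ℤ , e zero , zero-mem (λ i → trans (cong (_- 0ℤ * vector (suc i)) (e (suc i)))
                                        (ℤ.*-zeroˡ (vector (suc i))))
  decompose (gen-mem ℓ∈ e) with All.lookup divides-heads ℓ∈ | reduce∈ divides-heads ℓ∈
  ... | divides q eq | red∈ = q , trans (e zero) eq ,
        gen-mem red∈ (λ i → cong (_- q * vector (suc i)) (e (suc i)))
  decompose (add-mem {u} {v} s t e) with decompose s | decompose t
  ... | a , ha , sa | b , hb , sb = a + b ,
        trans (e zero) (trans (cong₂ _+_ ha hb) (sym (ℤ.*-distribʳ-+ (+ g) a b))) ,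
        add-mem sa sb (λ i → trans (cong (_- (a + b) * vector (suc i)) (e (suc i)))
                                   (regroup (u (suc i)) (v (suc i)) a b (vector (suc i))))
    where
    regroup : ∀ x y a b p → x + y - (a + b) * p ≡ (x - a * p) + (y - b * p)
    regroup = solve-∀
  decompose (neg-mem {u} s e) with decompose s
  ... | a , ha , sa = - a ,
        trans (e zero) (trans (cong -_ ha) (ℤ.neg-distribˡ-* a (+ g))) ,
        neg-mem sa (λ i → trans (cong (_- (- a) * vector (suc i)) (e (suc i)))
                                (regroup (u (suc i)) a (vector (suc i))))
    where
    regroup : ∀ x a p → - x - (- a) * p ≡ - (x - a * p)
    regroup = solve-∀

  separate-indivisible : ∀ {d} → ¬ (+ g ∣ head d) → Separable gs d
  separate-indivisible {d} g∤d with separate-ideal g (head d) g∤d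
  ... | N , never = N , λ (y , d-My∈) →
    let t , head≡t*g , _ = decompose d-My∈ in never t (head y) head≡t*g

  residue : ℤ → ℤ^ (suc m) → ℤ^ m
  residue q d = tail d ⊖ q ⊛ tail vector

  residue∉ : ∀ {d} q → head d ≡ q * + g → ¬ Span gs d → ¬ Span reduced (residue q d)
  residue∉ {d} q head≡q*g d∉ r∈ =
    d∉ (add-mem (span-scale q vector∈) (lift r∈) pointwise)
    where
    pointwise : d ≗ q ⊛ vector ⊕ (0ℤ ∷ᵛ residue q d)
    pointwise zero = begin
      head d             ≡⟨ head≡q*g ⟩
      q * + g            ≡⟨ cong (q *_) head≡ ⟨
      q * head vector    ≡⟨ ℤ.+-identityʳ _ ⟨
      q * head vector + 0ℤ ∎
      where open ≡-Reasoning
    pointwise (suc i) = split (d (suc i)) (q * vector (suc i))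
      where
      split : ∀ x z → x ≡ z + (x - z)
      split = solve-∀

ResiduallyFinite : ℕ → Set
ResiduallyFinite n = ∀ (gs : List (ℤ^ n)) d → ¬ Span gs d → Separable gs d

cancel-head : ∀ {x q t G K y₀} .{{_ : ℤ.NonZero G}} →
  x ≡ q * G → x - G * K * y₀ ≡ t * G → q ≡ t + K * y₀
cancel-head {x} {q} {t} {G} {K} {y₀} x≡qG x-GKy₀≡tG = begin
  q              ≡⟨ shift q t ⟩
  t + (q - t)    ≡⟨ cong (λ z → t + z) (ℤ.*-cancelʳ-≡ (q - t) (K * y₀) G quotients) ⟩
  t + K * y₀     ∎
  where
  open ≡-Reasoning
  shift : ∀ q t → q ≡ t + (q - t)
  shift = solve-∀
  expand : ∀ q t G → (q - t) * G ≡ q * G - t * G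
  expand = solve-∀
  collapse : ∀ x G K y₀ → x - (x - G * K * y₀) ≡ K * y₀ * G
  collapse = solve-∀
  quotients : (q - t) * G ≡ K * y₀ * G
  quotients = begin
    (q - t) * G                 ≡⟨ expand q t G ⟩
    q * G - t * G               ≡⟨ cong₂ _-_ x≡qG x-GKy₀≡tG ⟨
    x - (x - G * K * y₀)        ≡⟨ collapse x G K y₀ ⟩
    K * y₀ * G                  ∎

-- Divisible case with g > 0: if the residue avoids ⟨reduced⟩ + Kℤᵐ, then d
-- avoids ⟨gs⟩ + (g·K)ℤ¹⁺ᵐ: from d - gK·y ∈ ⟨gs⟩ with head t·g one gets
-- q = t + K·y₀, which makes the residue K-congruent to a member of ⟨reduced⟩.
separate-divisible-suc : ∀ {m} {gs : List (ℤ^ (suc m))} {n} (P : Pivot gs (suc n)) {d} q →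
  head d ≡ q * + suc n → ∀ N′ →
  ¬ SpanMod (Reduction.reduced P) (suc N′) (Reduction.residue P q d) →
  ¬ SpanMod gs (suc n ℕ.* suc N′) d
separate-divisible-suc {n = n} P {d} q head≡q*g N′ res∉ (y , d-My∈)
  with Reduction.decompose P d-My∈
... | t , head≡t*g , r∈ = res∉ (G ⊛ tail y ⊖ y₀ ⊛ tail vector , span-resp r∈ pointwise)
  where
  open Pivot P
  G K y₀ : ℤ
  G  = + suc n
  K  = + suc N′
  y₀ = head y

  modulus : + (suc n ℕ.* suc N′) ≡ G * K
  modulus = ℤ.pos-* (suc n) (suc N′)

  q≡ : q ≡ t + K * y₀
  q≡ = cancel-head {t = t} {G} {K} {y₀} head≡q*g
         (trans (cong (λ M → head d - M * y₀) (sym modulus)) head≡t*g)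

  pointwise : Reduction.residue P q d ⊖ K ⊛ (G ⊛ tail y ⊖ y₀ ⊛ tail vector)
            ≗ tail (d ⊖ + (suc n ℕ.* suc N′) ⊛ y) ⊖ t ⊛ tail vector
  pointwise i = begin
    d (suc i) - q * p - K * (G * y (suc i) - y₀ * p)
      ≡⟨ cong (λ q → d (suc i) - q * p - K * (G * y (suc i) - y₀ * p)) q≡ ⟩
    d (suc i) - (t + K * y₀) * p - K * (G * y (suc i) - y₀ * p)
      ≡⟨ regroup (d (suc i)) t K y₀ p G (y (suc i)) ⟩
    d (suc i) - G * K * y (suc i) - t * p
      ≡⟨ cong (λ M → d (suc i) - M * y (suc i) - t * p) modulus ⟨
    d (suc i) - + (suc n ℕ.* suc N′) * y (suc i) - t * p
      ∎
    where
    open ≡-Reasoning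
    p : ℤ
    p = vector (suc i)
    regroup : ∀ x t K y₀ p G y → x - (t + K * y₀) * p - K * (G * y - y₀ * p) ≡ x - G * K * y - t * p
    regroup = solve-∀

-- When g = 0 the zero vector is a pivot as well; its reduced generators are
-- just the tails of the generators.
null-pivot : ∀ {m} {gs : List (ℤ^ (suc m))} → Pivot gs 0 → Pivot gs 0
null-pivot P = record
  { vector = 𝟎 ; vector∈ = zero-mem (λ _ → refl) ; head≡ = refl
  ; divides-heads = Pivot.divides-heads P }

separate-divisible-zero : ∀ {m} {gs : List (ℤ^ (suc m))} (P : Pivot gs 0) {d} q M →
  ¬ SpanMod (Reduction.reduced (null-pivot P)) M (Reduction.residue (null-pivot P) q d) →
  ¬ SpanMod gs M d
separate-divisible-zero P {d} q M res∉ (y , d-My∈)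
  with Reduction.decompose (null-pivot P) d-My∈
... | t , _ , r∈ = res∉ (tail y , span-resp r∈ λ i → regroup (d (suc i)) q (+ M) (y (suc i)) t)
  where
  regroup : ∀ x q M y t → x - q * 0ℤ - M * y ≡ x - M * y - t * 0ℤ
  regroup = solve-∀

separate-divisible : ∀ {m} {gs : List (ℤ^ (suc m))} {g d} → Pivot gs g →
  + g ∣ head d → ¬ Span gs d → ResiduallyFinite m → Separable gs d
separate-divisible {g = zero} {d} P (divides q eq) d∉ rf
  with rf _ _ (Reduction.residue∉ (null-pivot P) {d} q eq d∉)
... | N′ , res∉ = N′ , separate-divisible-zero P {d} q (suc N′) res∉
separate-divisible {g = suc n} {d} P (divides q eq) d∉ rf
  with rf _ _ (Reduction.residue∉ P {d} q eq d∉)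
... | N′ , res∉ = N′ ℕ.+ n ℕ.* suc N′ , separate-divisible-suc P {d} q eq N′ res∉

residually-finite : ∀ n → ResiduallyFinite n
residually-finite zero    gs d d∉ = ⊥-elim (d∉ (zero-mem (λ ())))
residually-finite (suc m) gs d d∉ with pivot-exists gs
... | g , P with + g ∣? head d
... | no  g∤d = Reduction.separate-indivisible P {d} g∤d
... | yes g∣d = separate-divisible P g∣d d∉ (residually-finite m)

spanmod-coarsen : ∀ {n} {gs : List (ℤ^ n)} {k M d} → k ℕ.∣ M → SpanMod gs M d → SpanMod gs k d
spanmod-coarsen {k = k} {d = d} (ℕ.divides j refl) (y , s) =
  + j ⊛ y , span-resp s λ i → cong (λ x → d i - x) (begin
    + k * (+ j * y i)  ≡⟨ ℤ.*-assoc (+ k) (+ j) (y i) ⟨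
    + k * + j * y i    ≡⟨ cong (_* y i) (ℤ.*-comm (+ k) (+ j)) ⟩
    + j * + k * y i    ≡⟨ cong (_* y i) (ℤ.pos-* j k) ⟨
    + (j ℕ.* k) * y i  ∎)
  where open ≡-Reasoning

common-refinement : ∀ {n} {gs : List (ℤ^ n)} N₁ N₂ → ∃[ N ] ∀ {d} →
  SpanMod gs (suc N) d → SpanMod gs (suc N₁) d × SpanMod gs (suc N₂) d
common-refinement {gs = gs} N₁ N₂ = N₂ ℕ.+ N₁ ℕ.* suc N₂ , λ {d} s →
  spanmod-coarsen {gs = gs} {d = d} (ℕ.m∣m*n {suc N₁} (suc N₂)) s ,
  spanmod-coarsen {gs = gs} {d = d} (ℕ.n∣m*n (suc N₁) {suc N₂}) s

separate-all : ∀ {n} {A : Set} (gs : List (ℤ^ n)) (D : A → ℤ^ n) {Q : A → Set} →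
  (∀ x → Dec (Q x)) → ∀ xs → (∀ {x} → x ∈ xs → Span gs (D x) → Q x) →
  ∃[ N ] ∀ {x} → x ∈ xs → SpanMod gs (suc N) (D x) → Q x
separate-all gs D Q? [] _ = 0 , λ ()
separate-all gs D Q? (x ∷ xs) sound with separate-all gs D Q? xs (sound ∘ there) | Q? x
... | N₂ , rest | yes qx = N₂ , λ { (here refl) _ → qx ; (there x∈) → rest x∈ }
... | N₂ , rest | no ¬qx with residually-finite _ gs (D x) (¬qx ∘ sound (here refl))
... | N₁ , Dx∉ with common-refinement {gs = gs} N₁ N₂
... | N , refine = N , λ
  { (here refl) Dx∈ → ⊥-elim (Dx∉ (proj₁ (refine {D x} Dx∈)))
  ; {y} (there y∈) Dy∈ → rest y∈ (proj₂ (refine {D y} Dy∈)) }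

module SpanModClosure {n} (gs : List (ℤ^ n)) (M : ℕ) where

  spanmod-zero : ∀ {d} → d ≗ 𝟎 → SpanMod gs M d
  spanmod-zero {d} d≗0 = 𝟎 , zero-mem λ i →
    trans (cong₂ (λ x y → x - y) (d≗0 i) (ℤ.*-zeroʳ (+ M))) (ℤ.+-inverseʳ 0ℤ)

  spanmod-add : ∀ {a b d} → SpanMod gs M a → SpanMod gs M b → d ≗ a ⊕ b → SpanMod gs M d
  spanmod-add {a} {b} {d} (y₁ , s₁) (y₂ , s₂) d≗a+b = y₁ ⊕ y₂ , add-mem s₁ s₂ λ i →
    trans (cong (λ x → x - + M * (y₁ i + y₂ i)) (d≗a+b i)) (regroup (a i) (b i) (+ M) (y₁ i) (y₂ i))
    where
    regroup : ∀ a b M y₁ y₂ → a + b - M * (y₁ + y₂) ≡ (a - M * y₁) + (b - M * y₂)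
    regroup = solve-∀

  spanmod-neg : ∀ {a d} → SpanMod gs M a → d ≗ ⊝ a → SpanMod gs M d
  spanmod-neg {a} {d} (y , s) d≗-a = ⊝ y , neg-mem s λ i →
    trans (cong (λ x → x - + M * - y i) (d≗-a i)) (regroup (a i) (+ M) (y i))
    where
    regroup : ∀ a M y → - a - M * - y ≡ - (a - M * y)
    regroup = solve-∀

span⊆spanmod : ∀ {n} {gs : List (ℤ^ n)} {M d} → Span gs d → SpanMod gs M d
span⊆spanmod {M = M} {d} d∈ = 𝟎 , span-resp d∈ λ i →
  trans (cong (λ z → d i - z) (ℤ.*-zeroʳ (+ M))) (ℤ.+-identityʳ (d i))

module Quotient {n} (gs : List (ℤ^ n)) (M : ℕ) where
  open SpanModClosure gs M

  _≈_ : ℤ^ n → ℤ^ n → Set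
  u ≈ v = SpanMod gs M (u ⊖ v)

  ≈-reflexive : ∀ {u v} → u ≗ v → u ≈ v
  ≈-reflexive {u} {v} u≗v = spanmod-zero λ i → trans (cong (_- v i) (u≗v i)) (ℤ.+-inverseʳ (v i))

  isAbelianGroup : IsAbelianGroup _≈_ _⊕_ 𝟎 ⊝_
  isAbelianGroup = record
    { isGroup = record
      { isMonoid = record
        { isSemigroup = record
          { isMagma = record
            { isEquivalence = record
              { refl  = λ {x} → ≈-reflexive {x} {x} (λ _ → refl)
              ; sym   = λ {x} {y} x≈y → spanmod-neg {a = x ⊖ y} x≈y (λ i → flip (x i) (y i))
              ; trans = λ {x} {y} {z} x≈y y≈z → spanmod-add {a = x ⊖ y} {b = y ⊖ z} x≈y y≈z (λ i → chain (x i) (y i) (z i))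
              }
            ; ∙-cong = λ {x} {y} {u} {v} x≈y u≈v →
                spanmod-add {a = x ⊖ y} {b = u ⊖ v} x≈y u≈v (λ i → interchange (x i) (y i) (u i) (v i))
            }
          ; assoc = λ x y z → ≈-reflexive (λ i → ℤ.+-assoc (x i) (y i) (z i))
          }
        ; identity = (λ x → ≈-reflexive (λ i → ℤ.+-identityˡ (x i)))
                   , (λ x → ≈-reflexive (λ i → ℤ.+-identityʳ (x i)))
        }
      ; inverse = (λ x → ≈-reflexive (λ i → ℤ.+-inverseˡ (x i)))
                , (λ x → ≈-reflexive (λ i → ℤ.+-inverseʳ (x i)))
      ; ⁻¹-cong = λ {x} {y} x≈y → spanmod-neg {a = x ⊖ y} x≈y (λ i → negate (x i) (y i))
      }
    ; comm = λ x y → ≈-reflexive (λ i → ℤ.+-comm (x i) (y i))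
    }
    where
    flip : ∀ x y → y - x ≡ - (x - y)
    flip = solve-∀
    chain : ∀ x y z → x - z ≡ (x - y) + (y - z)
    chain = solve-∀
    interchange : ∀ x y u v → (x + u) - (y + v) ≡ (x - y) + (u - v)
    interchange = solve-∀
    negate : ∀ x y → - x - - y ≡ - (x - y)
    negate = solve-∀

  group : AbelianGroup 0ℓ 0ℓ
  group = record { isAbelianGroup = isAbelianGroup }

residues : ∀ M k → Fin (M ^ k) → ℤ^ k
residues M zero    _ = 𝟎
residues M (suc k) i = uncurry (λ a j → + toℕ a ∷ᵛ residues M k j) (remQuot {M} (M ^ k) i)

residues-combine : ∀ M k (a : Fin M) j → residues M (suc k) (combine a j) ≡ + toℕ a ∷ᵛ residues M k j
residues-combine M k a j =
  cong (uncurry λ a j → + toℕ a ∷ᵛ residues M k j) (Fin.remQuot-combine {M} {M ^ k} a j)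

residue-representation : ∀ N k (x : ℤ^ k) →
  ∃₂ λ i y → x ≗ residues (suc N) k i ⊕ + suc N ⊛ y
residue-representation N zero    x = zero , 𝟎 , λ ()
residue-representation N (suc k) x with residue-representation N k (tail x)
... | j , y , tail≗ = combine a j , head x /ℕ suc N ∷ᵛ y , λ i →
  trans (pointwise i) (cong (λ r → r i + + suc N * (head x /ℕ suc N ∷ᵛ y) i)
                            (sym (residues-combine (suc N) k a j)))
  where
  a : Fin (suc N)
  a = fromℕ< (n%ℕd<d (head x) (suc N))
  pointwise : x ≗ (+ toℕ a ∷ᵛ residues (suc N) k j) ⊕ + suc N ⊛ (head x /ℕ suc N ∷ᵛ y)
  pointwise zero = begin
    head x                                             ≡⟨ a≡a%ℕn+[a/ℕn]*n (head x) (suc N) ⟩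
    + (head x %ℕ suc N) + (head x /ℕ suc N) * + suc N  ≡⟨ cong₂ (λ r q → + r + q)
                                                            (Fin.toℕ-fromℕ< (n%ℕd<d (head x) (suc N)))
                                                            (ℤ.*-comm (+ suc N) (head x /ℕ suc N)) ⟨
    + toℕ a + + suc N * (head x /ℕ suc N)              ∎
    where open ≡-Reasoning
  pointwise (suc i) = tail≗ i

quotient-finite : ∀ {n} (gs : List (ℤ^ n)) N → IsFinite (Quotient.group gs (suc N))
quotient-finite {n} gs N = suc N ^ n , residues (suc N) n , λ x →
  let i , y , x≗ = residue-representation N n x
  in i , ⊝ y , zero-mem λ c →
       trans (cong (λ v → residues (suc N) n i c - v - + suc N * - y c) (x≗ c))
             (cancel (residues (suc N) n i c) (+ suc N) (y c))
  where
  cancel : ∀ r M y → r - (r + M * y) - M * - y ≡ 0ℤ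
  cancel = solve-∀

indicator : ∀ {n} → Fin n → ℤ^ n
indicator zero    zero    = 1ℤ
indicator zero    (suc j) = 0ℤ
indicator (suc i) zero    = 0ℤ
indicator (suc i) (suc j) = indicator i j

module Multiples (G : AbelianGroup 0ℓ 0ℓ) where
  open AbelianGroup G renaming (refl to ≈-refl; sym to ≈-sym; trans to ≈-trans)
  open import Algebra.Properties.Group group using (ε⁻¹≈ε; ⁻¹-involutive)
  open import Algebra.Properties.AbelianGroup G using (⁻¹-∙-comm)
  open import Algebra.Properties.CommutativeSemigroup commutativeSemigroup using (interchange)
  open import Relation.Binary.Reasoning.Setoid setoid

  natMul-+ : ∀ a b x → natMul G (a ℕ.+ b) x ≈ natMul G a x ∙ natMul G b x
  natMul-+ zero    b x = ≈-sym (identityˡ _)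
  natMul-+ (suc a) b x = ≈-trans (∙-congˡ (natMul-+ a b x)) (≈-sym (assoc _ _ _))

  intMul-⊖ : ∀ p q x → intMul G (p ℤ.⊖ q) x ≈ natMul G p x ∙ natMul G q x ⁻¹
  intMul-⊖ p zero x = begin
    natMul G p x          ≈⟨ identityʳ _ ⟨
    natMul G p x ∙ ε      ≈⟨ ∙-congˡ ε⁻¹≈ε ⟨
    natMul G p x ∙ ε ⁻¹   ∎
  intMul-⊖ zero (suc q) x = ≈-sym (identityˡ _)
  intMul-⊖ (suc p) (suc q) x = begin
    intMul G (suc p ℤ.⊖ suc q) x              ≡⟨ cong (λ z → intMul G z x) (ℤ.[1+m]⊖[1+n]≡m⊖n p q) ⟩
    intMul G (p ℤ.⊖ q) x                      ≈⟨ intMul-⊖ p q x ⟩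
    natMul G p x ∙ natMul G q x ⁻¹            ≈⟨ identityˡ _ ⟨
    ε ∙ (natMul G p x ∙ natMul G q x ⁻¹)      ≈⟨ ∙-congʳ (inverseʳ x) ⟨
    (x ∙ x ⁻¹) ∙ (natMul G p x ∙ natMul G q x ⁻¹) ≈⟨ interchange _ _ _ _ ⟩
    (x ∙ natMul G p x) ∙ (x ⁻¹ ∙ natMul G q x ⁻¹) ≈⟨ ∙-congˡ (⁻¹-∙-comm x (natMul G q x)) ⟩
    (x ∙ natMul G p x) ∙ (x ∙ natMul G q x) ⁻¹    ∎

  intMul-+ : ∀ a b x → intMul G (a + b) x ≈ intMul G a x ∙ intMul G b x
  intMul-+ (+ a)    (+ b)    x = natMul-+ a b x
  intMul-+ (+ a)    -[1+ b ] x = intMul-⊖ a (suc b) x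
  intMul-+ -[1+ a ] (+ b)    x = ≈-trans (intMul-⊖ b (suc a) x) (comm _ _)
  intMul-+ -[1+ a ] -[1+ b ] x = begin
    natMul G (suc (suc (a ℕ.+ b))) x ⁻¹             ≡⟨ cong (λ k → natMul G (suc k) x ⁻¹) (ℕ.+-suc a b) ⟨
    natMul G (suc a ℕ.+ suc b) x ⁻¹                 ≈⟨ ⁻¹-cong (natMul-+ (suc a) (suc b) x) ⟩
    (natMul G (suc a) x ∙ natMul G (suc b) x) ⁻¹    ≈⟨ ⁻¹-∙-comm _ _ ⟨
    natMul G (suc a) x ⁻¹ ∙ natMul G (suc b) x ⁻¹   ∎

  intMul-neg : ∀ a x → intMul G (- a) x ≈ intMul G a x ⁻¹
  intMul-neg (+ zero)  x = ≈-sym ε⁻¹≈ε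
  intMul-neg (+ suc n) x = ≈-refl
  intMul-neg -[1+ n ]  x = ≈-sym (⁻¹-involutive _)

  sumFin-cong : ∀ n {u v : Fin n → Carrier} → (∀ i → u i ≈ v i) → sumFin G n u ≈ sumFin G n v
  sumFin-cong zero    u≈v = ≈-refl
  sumFin-cong (suc n) u≈v = ∙-cong (u≈v zero) (sumFin-cong n (u≈v ∘ suc))

  sumFin-ε : ∀ n {u : Fin n → Carrier} → (∀ i → u i ≈ ε) → sumFin G n u ≈ ε
  sumFin-ε zero    u≈ε = ≈-refl
  sumFin-ε (suc n) u≈ε = ≈-trans (∙-cong (u≈ε zero) (sumFin-ε n (u≈ε ∘ suc))) (identityˡ ε)

  sumFin-∙ : ∀ n (u v : Fin n → Carrier) → sumFin G n (λ i → u i ∙ v i) ≈ sumFin G n u ∙ sumFin G n v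
  sumFin-∙ zero    u v = ≈-sym (identityˡ ε)
  sumFin-∙ (suc n) u v = ≈-trans (∙-congˡ (sumFin-∙ n (u ∘ suc) (v ∘ suc))) (interchange _ _ _ _)

  sumFin-⁻¹ : ∀ n (u : Fin n → Carrier) → sumFin G n (λ i → u i ⁻¹) ≈ sumFin G n u ⁻¹
  sumFin-⁻¹ zero    u = ≈-sym ε⁻¹≈ε
  sumFin-⁻¹ (suc n) u = ≈-trans (∙-congˡ (sumFin-⁻¹ n (u ∘ suc))) (⁻¹-∙-comm _ _)

  module Evaluation (n : ℕ) (gen : Fin n → Carrier) where

    eval : ℤ^ n → Carrier
    eval v = sumFin G n (λ i → intMul G (v i) (gen i))

    eval-cong : ∀ {u v} → u ≗ v → eval u ≈ eval v
    eval-cong u≗v = sumFin-cong n (λ i → reflexive (cong (λ c → intMul G c (gen i)) (u≗v i)))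

    eval-⊕ : ∀ u v → eval (u ⊕ v) ≈ eval u ∙ eval v
    eval-⊕ u v = ≈-trans (sumFin-cong n (λ i → intMul-+ (u i) (v i) (gen i))) (sumFin-∙ n _ _)

    eval-⊝ : ∀ u → eval (⊝ u) ≈ eval u ⁻¹
    eval-⊝ u = ≈-trans (sumFin-cong n (λ i → intMul-neg (u i) (gen i))) (sumFin-⁻¹ n _)

    eval-⊖ : ∀ u v → eval (u ⊖ v) ≈ eval u ∙ eval v ⁻¹
    eval-⊖ u v = ≈-trans (eval-⊕ u (⊝ v)) (∙-congˡ (eval-⊝ v))

    eval-span : ∀ {gs} → (∀ {g} → g ∈ gs → eval g ≈ ε) → ∀ {v} → Span gs v → eval v ≈ ε
    eval-span gs⊆ker (zero-mem v≗0) =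
      ≈-trans (eval-cong v≗0) (sumFin-ε n (λ i → ≈-refl))
    eval-span gs⊆ker (gen-mem g∈ v≗g) = ≈-trans (eval-cong v≗g) (gs⊆ker g∈)
    eval-span gs⊆ker {v} (add-mem {u} {w} s t v≗) = begin
      eval v              ≈⟨ eval-cong v≗ ⟩
      eval (u ⊕ w)        ≈⟨ eval-⊕ u w ⟩
      eval u ∙ eval w     ≈⟨ ∙-cong (eval-span gs⊆ker s) (eval-span gs⊆ker t) ⟩
      ε ∙ ε               ≈⟨ identityˡ ε ⟩
      ε                   ∎
    eval-span gs⊆ker {v} (neg-mem {u} s v≗) = begin
      eval v              ≈⟨ eval-cong v≗ ⟩
      eval (⊝ u)          ≈⟨ eval-⊝ u ⟩
      eval u ⁻¹           ≈⟨ ⁻¹-cong (eval-span gs⊆ker s) ⟩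
      ε ⁻¹                ≈⟨ ε⁻¹≈ε ⟩
      ε                   ∎

    eval-indicator : ∀ i → eval (indicator i) ≈ gen i
    eval-indicator = sum-indicator n gen
      where
      sum-indicator : ∀ n (e : Fin n → Carrier) i →
                      sumFin G n (λ j → intMul G (indicator i j) (e j)) ≈ e i
      sum-indicator (suc n) e zero = begin
        (e zero ∙ ε) ∙ sumFin G n (λ _ → ε)  ≈⟨ ∙-cong (identityʳ _) (sumFin-ε n (λ _ → ≈-refl)) ⟩
        e zero ∙ ε                           ≈⟨ identityʳ _ ⟩
        e zero                               ∎
      sum-indicator (suc n) e (suc i) = ≈-trans (identityˡ _) (sum-indicator n (e ∘ suc) i)

finite⇒finitely-generated : ∀ G → IsFinite G → IsFinitelyGenerated G
finite⇒finitely-generated G (n , e , onto) = n , e , λ x →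
  let i , eᵢ≈x = onto x in indicator i , ≈-sym (≈-trans (eval-indicator i) eᵢ≈x)
  where
  open AbelianGroup G using () renaming (sym to ≈-sym; trans to ≈-trans)
  open Multiples G
  open Evaluation n e

data Coordinate : Set where
  row column symbol : Coordinate

coordinates : List Coordinate
coordinates = row ∷ column ∷ symbol ∷ []

coordinate∈ : ∀ κ → κ ∈ coordinates
coordinate∈ row    = here refl
coordinate∈ column = there (here refl)
coordinate∈ symbol = there (there (here refl))

label : Coordinate → Triple → ℕ
label row    (r , _ , _) = r
label column (_ , c , _) = c
label symbol (_ , _ , s) = s

module Transport (W : List Triple) (G : AbelianGroup 0ℓ 0ℓ)
  (n : ℕ) (gen : Fin n → AbelianGroup.Carrier G)
  (represent : ∀ x → Σ (ℤ^ n) λ z → AbelianGroup._≈_ G x (sumFin G n (λ i → intMul G (z i) (gen i))))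
  (embedding : Embeds G W) where

  open AbelianGroup G renaming (refl to ≈-refl; sym to ≈-sym; trans to ≈-trans)
  open Multiples G
  open Evaluation n gen
  open import Algebra.Properties.Group group using (x∙y⁻¹≈ε⇒x≈y)
  open import Relation.Binary.Reasoning.Setoid setoid

  f h k : ℕ → Carrier
  f = proj₁ embedding
  h = proj₁ (proj₂ embedding)
  k = proj₁ (proj₂ (proj₂ embedding))

  labelled : Coordinate → ℕ → Carrier
  labelled row    = f
  labelled column = h
  labelled symbol = k

  labelled-injective : ∀ κ {t t′} → t ∈ W → t′ ∈ W →
    labelled κ (label κ t) ≈ labelled κ (label κ t′) → label κ t ≡ label κ t′
  labelled-injective row    {_ , _ , _} {_ , _ , _} = proj₁ (proj₂ (proj₂ (proj₂ embedding)))
  labelled-injective column {_ , _ , _} {_ , _ , _} = proj₁ (proj₂ (proj₂ (proj₂ (proj₂ embedding))))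
  labelled-injective symbol {_ , _ , _} {_ , _ , _} = proj₁ (proj₂ (proj₂ (proj₂ (proj₂ (proj₂ embedding)))))

  compatible : ∀ {r c s} → (r , c , s) ∈ W → f r ∙ h c ≈ k s
  compatible = proj₂ (proj₂ (proj₂ (proj₂ (proj₂ (proj₂ embedding)))))

  coords : Carrier → ℤ^ n
  coords x = proj₁ (represent x)

  eval-coords : ∀ x → eval (coords x) ≈ x
  eval-coords x = ≈-sym (proj₂ (represent x))

  relation : Triple → ℤ^ n
  relation (r , c , s) = coords (f r) ⊕ coords (h c) ⊖ coords (k s)

  relations : List (ℤ^ n)
  relations = map relation W

  eval-relation : ∀ {t} → t ∈ W → eval (relation t) ≈ ε
  eval-relation {r , c , s} t∈ = begin
    eval (coords (f r) ⊕ coords (h c) ⊖ coords (k s))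
      ≈⟨ eval-⊖ (coords (f r) ⊕ coords (h c)) (coords (k s)) ⟩
    eval (coords (f r) ⊕ coords (h c)) ∙ eval (coords (k s)) ⁻¹
      ≈⟨ ∙-congʳ (eval-⊕ (coords (f r)) (coords (h c))) ⟩
    (eval (coords (f r)) ∙ eval (coords (h c))) ∙ eval (coords (k s)) ⁻¹
      ≈⟨ ∙-cong (∙-cong (eval-coords _) (eval-coords _)) (⁻¹-cong (eval-coords _)) ⟩
    (f r ∙ h c) ∙ k s ⁻¹
      ≈⟨ ∙-congʳ (compatible t∈) ⟩
    k s ∙ k s ⁻¹
      ≈⟨ inverseʳ _ ⟩
    ε ∎

  coords-faithful : ∀ a b → Span relations (coords a ⊖ coords b) → a ≈ b
  coords-faithful a b a-b∈ = begin
    a                    ≈⟨ eval-coords a ⟨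
    eval (coords a)      ≈⟨ x∙y⁻¹≈ε⇒x≈y _ _ (≈-trans (≈-sym (eval-⊖ (coords a) (coords b)))
                                                 (eval-span kernel a-b∈)) ⟩
    eval (coords b)      ≈⟨ eval-coords b ⟩
    b                    ∎
    where
    kernel : ∀ {g} → g ∈ relations → eval g ≈ ε
    kernel g∈ with ∈-map⁻ relation g∈
    ... | t , t∈ , refl = eval-relation t∈

  -- A separation obligation: a coordinate and two triples of W, to be told
  -- apart in the quotient whenever their labels differ.
  Obligation : Set
  Obligation = Coordinate × Triple × Triple

  obligations : List Obligation
  obligations = cartesianProduct coordinates (cartesianProduct W W)

  obligation∈ : ∀ κ {t t′} → t ∈ W → t′ ∈ W → (κ , t , t′) ∈ obligations
  obligation∈ κ t∈ t′∈ = ∈-cartesianProduct⁺ (coordinate∈ κ) (∈-cartesianProduct⁺ t∈ t′∈)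

  difference : Obligation → ℤ^ n
  difference (κ , t , t′) = coords (labelled κ (label κ t)) ⊖ coords (labelled κ (label κ t′))

  SameLabel : Obligation → Set
  SameLabel (κ , t , t′) = label κ t ≡ label κ t′

  same-label? : ∀ o → Dec (SameLabel o)
  same-label? (κ , t , t′) = label κ t ℕ.≟ label κ t′

  difference-sound : ∀ {o} → o ∈ obligations → Span relations (difference o) → SameLabel o
  difference-sound {κ , t , t′} o∈ d∈ =
    let _ , tt′∈ = ∈-cartesianProduct⁻ coordinates (cartesianProduct W W) o∈
        t∈ , t′∈ = ∈-cartesianProduct⁻ W W tt′∈
    in labelled-injective κ t∈ t′∈ (coords-faithful _ _ d∈)

  separation : ∃[ N ] ∀ {o} → o ∈ obligations → SpanMod relations (suc N) (difference o) → SameLabel o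
  separation = separate-all relations difference same-label? obligations difference-sound

  modulus : ℕ
  modulus = proj₁ separation

  quotient : AbelianGroup 0ℓ 0ℓ
  quotient = Quotient.group relations (suc modulus)

  embeds : Embeds quotient W
  embeds = coords ∘ f , coords ∘ h , coords ∘ k
         , (λ t∈ t′∈ → proj₂ separation (obligation∈ row t∈ t′∈))
         , (λ t∈ t′∈ → proj₂ separation (obligation∈ column t∈ t′∈))
         , (λ t∈ t′∈ → proj₂ separation (obligation∈ symbol t∈ t′∈))
         , (λ t∈ → span⊆spanmod {M = suc modulus} (gen-mem (∈-map⁺ relation t∈) (λ _ → refl)))

finitely-generated⇒finite : ∀ W → EmbedsInFinitelyGeneratedAbelianGroup W → EmbedsInFiniteAbelianGroup W
finitely-generated⇒finite W (G , (n , gen , represent) , embedding) =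
  quotient , quotient-finite relations modulus , embeds
  where open Transport W G n gen represent embedding

-- Corollary 3.14.
corollary3p14 : (W : List Triple) → IsLatinTrade W →
    EmbedsInFiniteAbelianGroup W ⇔ EmbedsInFinitelyGeneratedAbelianGroup W
corollary3p14 W _ = mk⇔
  (λ (G , finite , embedding) → G , finite⇒finitely-generated G finite , embedding)
  (finitely-generated⇒finite W)
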